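{- For every integer $a\ge 2$: (1) $C(2a;1,a)$ admits a $2$-bounded $\beta_b$-broadcast if $a$ is odd or $a=2^p$ for some integer $p\ge 1$; (2) $C(3a;1,a)$ admits a $2$-bounded $\beta_b$-broadcast.
   Context: For integers $n\ge 3$ and $1\le a\le\lfloor n/2\rfloor$, the circulant graph $C(n;1,a)$ has vertex set $\{v_0,\dots,v_{n-1}\}$ and edges $v_iv_{i+1}$ and $v_iv_{i+a}$, subscripts modulo $n$. For a connected graph $G$, a broadcast is a function $f:V(G)\to\{0,\dots,\mathrm{diam}(G)\}$ with $f(v)\le e(v)$ (eccentricity) for all $v$; $V_f^+=\{v:f(v)>0\}$. $f$ is independent if $d(u,v)>\max\{f(u),f(v)\}$ for all distinct $u,v\in V_f^+$. The cost is $\sigma(f)=\sum_v f(v)$; $\beta_b(G)$ is the maximum cost of an independent broadcast on $G$, and a $\beta_b$-broadcast is an independent broadcast of cost $\beta_b(G)$. An independent broadcast is $2$-bounded if $f(v)\le 2$ for every vertex $v$. -}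

module Defs where

open import Data.Nat using (ℕ; zero; suc; _+_; _*_; _^_; _≤_; _<_; _⊔_)
open import Data.Fin using (Fin; toℕ)
open import Data.List using (List; map; allFin)
open import Data.Nat.ListAction using (sum)
open import Data.Product using (Σ; ∃; _×_; _,_)
open import Data.Sum using (_⊎_)
open import Relation.Binary.PropositionalEquality using (_≡_; _≢_)

-- j = i + s (mod n), for 0 ≤ s < n (vertices are Fin n, i.e. indices 0..n-1)
StepBy : (n s : ℕ) → Fin n → Fin n → Set
StepBy n s i j = (toℕ j ≡ toℕ i + s) ⊎ (toℕ j + n ≡ toℕ i + s)

Adj : (n a : ℕ) → Fin n → Fin n → Set
Adj n a i j = StepBy n 1 i j ⊎ StepBy n 1 j i ⊎ StepBy n a i j ⊎ StepBy n a j i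

data Walk (n a : ℕ) : Fin n → Fin n → ℕ → Set where
  nil  : ∀ {u} → Walk n a u u 0
  cons : ∀ {u w v k} → Adj n a u w → Walk n a w v k → Walk n a u v (suc k)

DistGE : (n a : ℕ) → Fin n → Fin n → ℕ → Set
DistGE n a u v k = ∀ j → Walk n a u v j → k ≤ j

-- f is a broadcast: f(v) ≤ e(v), i.e. some w has d(v,w) ≥ f(v)
IsBroadcast : (n a : ℕ) → (Fin n → ℕ) → Set
IsBroadcast n a f = ∀ v → ∃ λ w → DistGE n a v w (f v)

IsIndependent : (n a : ℕ) → (Fin n → ℕ) → Set
IsIndependent n a f =
  IsBroadcast n a f ×
  (∀ u v → u ≢ v → 0 < f u → 0 < f v → DistGE n a u v (suc (f u ⊔ f v)))

cost : (n : ℕ) → (Fin n → ℕ) → ℕ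
cost n f = sum (map f (allFin n))

IsBetaBroadcast : (n a : ℕ) → (Fin n → ℕ) → Set
IsBetaBroadcast n a f =
  IsIndependent n a f × (∀ g → IsIndependent n a g → cost n g ≤ cost n f)

TwoBounded : (n : ℕ) → (Fin n → ℕ) → Set
TwoBounded n f = ∀ v → f v ≤ 2

Admits2BoundedBeta : (n a : ℕ) → Set
Admits2BoundedBeta n a = ∃ λ (f : Fin n → ℕ) → IsBetaBroadcast n a f × TwoBounded n f

Odd : ℕ → Set
Odd a = ∃ λ k → a ≡ suc (2 * k)

-- The upper bound is a packing argument.  A vertex u with g(u) > 0 claims the residues
-- u, u + 1, …, u + g(u) − 1 modulo a.  In C(ma;1,a) with m ≤ 3 two vertices of equal residue
-- are equal or adjacent, so a walk of length d + 1 leads from u to every vertex whose residue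
-- is u + d; independence therefore makes all claims distinct, and σ(g) ≤ a.
-- The value 1 on the even vertices of [0, a) and on the odd vertices of [a, a + b) is an
-- independent broadcast of cost at least b, where b = a except for m = 2 and a even, where the
-- last vertex 2a − 1 has to be dropped (b = a − 1).
-- For a = 2^p the bound a is not attained in C(2a;1,a): at cost a every residue is claimed, and
-- then from a vertex v of minimal positive value K the vertices v + j(K + a) all have value K.
-- With a = qK + ρ, the claim of v + q(K + a) at offset ρ is the residue of v, which forces ρ = 0
-- and q odd, hence q = 1 and K = a, whereas every eccentricity in C(2a;1,a) is below a.
module Submission where

open import Data.Nat
open import Data.Nat.Properties
open import Algebra.Properties.CommutativeSemigroup +-commutativeSemigroup using (x∙yz≈y∙xz)
open import Data.Nat.DivMod
open import Data.Nat.Divisibility using (_∣_; _∤_; divides; ∣-refl; ∣1⇒≡1)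
open import Data.Nat.Coprimality using (Coprime; coprime-divisor)
open import Data.Nat.Primality using (irreducible[2])
open import Data.Nat.Induction using (<-rec)
open import Data.Nat.ListAction using (sum)
open import Data.Nat.Tactic.RingSolver using (solve-∀)
open import Data.Fin using (Fin; toℕ; fromℕ<)
open import Data.Fin.Properties using (toℕ-fromℕ<; toℕ-injective; toℕ<n; injective⇒≤) renaming (_≟_ to _≟ᶠ_)
open import Data.List using (List; []; _∷_; length; lookup; map; concat; concatMap; applyUpTo; allFin; tabulate)
open import Data.List.Properties using (length-++; length-applyUpTo; map-∘; map-cong; map-tabulate)
open import Data.List.Membership.Propositional using (_∈_)
open import Data.List.Membership.Propositional.Properties using (∈-lookup; ∈-applyUpTo⁻; ∈-concat⁻′; ∈-map⁻)
open import Data.List.Membership.DecPropositional _≟_ using (_∈?_)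
open import Data.List.Relation.Unary.All as All using (All; []; _∷_)
import Data.List.Relation.Unary.All.Properties as All
import Data.List.Relation.Unary.AllPairs.Properties as AllPairs
open import Data.List.Relation.Unary.Unique.Propositional using (Unique; []; _∷_)
import Data.List.Relation.Unary.Unique.Propositional.Properties as Unique
open import Data.List.Relation.Binary.Disjoint.Propositional using (Disjoint)
open import Data.Empty using (⊥; ⊥-elim)
open import Data.Sum using (_⊎_; inj₁; inj₂; [_,_])
open import Data.Product using (∃; ∃₂; _×_; _,_; proj₁; proj₂)
open import Function using (id; _∘_)
open import Relation.Binary.PropositionalEquality
  using (_≡_; _≢_; refl; sym; trans; cong; cong₂; subst; subst₂; module ≡-Reasoning)
open import Relation.Nullary using (¬_; yes; no; contradiction)
open import Defs

-- Residues

[m%n+o]%n≡[m+o]%n : ∀ m o n .{{_ : NonZero n}} → (m % n + o) % n ≡ (m + o) % n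
[m%n+o]%n≡[m+o]%n m o n = begin
  (m % n + o) % n          ≡⟨ %-distribˡ-+ (m % n) o n ⟩
  (m % n % n + o % n) % n  ≡⟨ cong (λ r → (r + o % n) % n) (m%n%n≡m%n m n) ⟩
  (m % n + o % n) % n      ≡⟨ %-distribˡ-+ m o n ⟨
  (m + o) % n              ∎
  where open ≡-Reasoning

[m+o%n]%n≡[m+o]%n : ∀ m o n .{{_ : NonZero n}} → (m + o % n) % n ≡ (m + o) % n
[m+o%n]%n≡[m+o]%n m o n = begin
  (m + o % n) % n  ≡⟨ cong (_% n) (+-comm m (o % n)) ⟩
  (o % n + m) % n  ≡⟨ [m%n+o]%n≡[m+o]%n o m n ⟩
  (o + m) % n      ≡⟨ cong (_% n) (+-comm o m) ⟩
  (m + o) % n      ∎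
  where open ≡-Reasoning

%-cancelˡ-+ : ∀ k m o n .{{_ : NonZero n}} → (k + m) % n ≡ (k + o) % n → m % n ≡ o % n
%-cancelˡ-+ k m o n@(suc n-1) eq = begin
  m % n                        ≡⟨ unshift m ⟩
  (k * n-1 + (k + m) % n) % n  ≡⟨ cong (λ r → (k * n-1 + r) % n) eq ⟩
  (k * n-1 + (k + o) % n) % n  ≡⟨ unshift o ⟨
  o % n                        ∎
  where
  open ≡-Reasoning
  -- adding k * n, written as k * (n - 1) + k, does not change a residue
  unshift : ∀ x → x % n ≡ (k * n-1 + (k + x) % n) % n
  unshift x = begin
    x % n                        ≡⟨ [m+kn]%n≡m%n x k n ⟨
    (x + k * n) % n              ≡⟨ cong (_% n) (arith x k n-1) ⟩
    (k * n-1 + (k + x)) % n      ≡⟨ [m+o%n]%n≡[m+o]%n (k * n-1) (k + x) n ⟨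
    (k * n-1 + (k + x) % n) % n  ∎
    where
    arith : ∀ x k n-1 → x + k * suc n-1 ≡ k * n-1 + (k + x)
    arith = solve-∀

%-cancelʳ-+ : ∀ k m o n .{{_ : NonZero n}} → (m + k) % n ≡ (o + k) % n → m % n ≡ o % n
%-cancelʳ-+ k m o n eq = %-cancelˡ-+ k m o n (subst₂ (λ x y → x % n ≡ y % n) (+-comm m k) (+-comm o k) eq)

[m+o]%n≢m%n : ∀ m {o n} .{{_ : NonZero n}} → 0 < o → o < n → (m + o) % n ≢ m % n
[m+o]%n≢m%n m {o} {n} 0<o o<n eq = >⇒≢ 0<o (begin
  o      ≡⟨ m<n⇒m%n≡m o<n ⟨
  o % n  ≡⟨ %-cancelˡ-+ m o 0 n (trans eq (cong (_% n) (sym (+-identityʳ m)))) ⟩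
  0 % n  ≡⟨ m<n⇒m%n≡m (>-nonZero⁻¹ n) ⟩
  0      ∎)
  where open ≡-Reasoning

∃-offset : ∀ x y a .{{_ : NonZero a}} → ∃ λ d → d < a × (x + d) % a ≡ y % a
∃-offset x y a = (a ∸ x % a + y) % a , m%n<n _ a , (begin
  (x + (a ∸ x % a + y) % a) % a  ≡⟨ [m+o%n]%n≡[m+o]%n x _ a ⟩
  (x + (a ∸ x % a + y)) % a      ≡⟨ [m%n+o]%n≡[m+o]%n x _ a ⟨
  (x % a + (a ∸ x % a + y)) % a  ≡⟨ cong (_% a) (+-assoc (x % a) _ y) ⟨
  (x % a + (a ∸ x % a) + y) % a  ≡⟨ cong (λ r → (r + y) % a) (m+[n∸m]≡n (m%n≤n x a)) ⟩
  (a + y) % a                    ≡⟨ %-remove-+ˡ y (∣-refl {a}) ⟩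
  y % a                          ∎)
  where open ≡-Reasoning

2∤m∧m∣2^n⇒m≡1 : ∀ {m} n → 2 ∤ m → m ∣ 2 ^ n → m ≡ 1
2∤m∧m∣2^n⇒m≡1 zero    _   m∣1        = ∣1⇒≡1 m∣1
2∤m∧m∣2^n⇒m≡1 (suc n) 2∤m m∣2^[1+n] = 2∤m∧m∣2^n⇒m≡1 n 2∤m (coprime-divisor coprime-2 m∣2^[1+n])
  where
  coprime-2 : Coprime _ 2
  coprime-2 (d∣m , d∣2) with irreducible[2] d∣2
  ... | inj₁ d≡1  = d≡1
  ... | inj₂ refl = contradiction d∣m 2∤m

-- Parity and finite sums

isEven isOdd : ℕ → ℕ
isEven zero    = 1
isEven (suc x) = isOdd x
isOdd zero    = 0
isOdd (suc x) = isEven x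

isEven+isOdd≡1 : ∀ x → isEven x + isOdd x ≡ 1
isEven+isOdd≡1 zero    = refl
isEven+isOdd≡1 (suc x) = trans (+-comm (isOdd x) (isEven x)) (isEven+isOdd≡1 x)

isEven≤1 : ∀ x → isEven x ≤ 1
isEven≤1 x = subst (isEven x ≤_) (isEven+isOdd≡1 x) (m≤m+n _ _)

isOdd≤1 : ∀ x → isOdd x ≤ 1
isOdd≤1 x = subst (isOdd x ≤_) (isEven+isOdd≡1 x) (m≤n+m _ _)

isEven≡1∧isOdd≡1⇒⊥ : ∀ x → isEven x ≡ 1 → isOdd x ≡ 1 → ⊥
isEven≡1∧isOdd≡1⇒⊥ x even odd with () ← trans (sym (cong₂ _+_ even odd)) (isEven+isOdd≡1 x)

isOdd[2*n]≡0 : ∀ n → isOdd (2 * n) ≡ 0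
isOdd[2*n]≡0 zero    = refl
isOdd[2*n]≡0 (suc n) = trans (cong isOdd (*-suc 2 n)) (isOdd[2*n]≡0 n)

sum-applyUpTo-+ : ∀ (f : ℕ → ℕ) p q →
                  sum (applyUpTo f (p + q)) ≡ sum (applyUpTo f p) + sum (applyUpTo (f ∘ (p +_)) q)
sum-applyUpTo-+ f zero    q = refl
sum-applyUpTo-+ f (suc p) q = trans (cong (f 0 +_) (sum-applyUpTo-+ (f ∘ suc) p q)) (sym (+-assoc (f 0) _ _))

sum-applyUpTo-≤ : ∀ (f : ℕ → ℕ) {p q} → p ≤ q → sum (applyUpTo f p) ≤ sum (applyUpTo f q)
sum-applyUpTo-≤ f {p} p≤q with r , refl ← m≤n⇒∃[o]m+o≡n p≤q =
  subst (sum (applyUpTo f p) ≤_) (sym (sum-applyUpTo-+ f p r)) (m≤m+n _ _)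

sum-applyUpTo-cong : ∀ {f h : ℕ → ℕ} k → (∀ {x} → x < k → f x ≡ h x) →
                     sum (applyUpTo f k) ≡ sum (applyUpTo h k)
sum-applyUpTo-cong zero    f≗h = refl
sum-applyUpTo-cong (suc k) f≗h = cong₂ _+_ (f≗h z<s) (sum-applyUpTo-cong k (f≗h ∘ s<s))

sum-isEven+sum-isOdd : ∀ k → sum (applyUpTo isEven k) + sum (applyUpTo isOdd k) ≡ k
sum-isEven+sum-isOdd zero    = refl
sum-isEven+sum-isOdd (suc k) =
  cong suc (trans (+-comm (sum (applyUpTo isOdd k)) _) (sum-isEven+sum-isOdd k))

tabulate-toℕ : ∀ n (f : ℕ → ℕ) → tabulate {n = n} (f ∘ toℕ) ≡ applyUpTo f n
tabulate-toℕ zero    f = refl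
tabulate-toℕ (suc n) f = cong (f 0 ∷_) (tabulate-toℕ n (f ∘ suc))

cost-toℕ : ∀ n (f : ℕ → ℕ) → cost n (f ∘ toℕ) ≡ sum (applyUpTo f n)
cost-toℕ n f = cong sum (trans (map-tabulate id (f ∘ toℕ)) (tabulate-toℕ n f))

-- Counting injective claims

lookup-injective : ∀ {A : Set} {xs : List A} → Unique xs → ∀ i j → lookup xs i ≡ lookup xs j → i ≡ j
lookup-injective (_  ∷ _) Fin.zero    Fin.zero    _  = refl
lookup-injective (x∉ ∷ _) Fin.zero    (Fin.suc j) eq = contradiction eq (All.lookup x∉ (∈-lookup j))
lookup-injective (x∉ ∷ _) (Fin.suc i) Fin.zero    eq = contradiction (sym eq) (All.lookup x∉ (∈-lookup i))
lookup-injective (_  ∷ u) (Fin.suc i) (Fin.suc j) eq = cong Fin.suc (lookup-injective u i j eq)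

unique∧bounded⇒length≤ : ∀ {A ns} → Unique ns → All (_< A) ns → length ns ≤ A
unique∧bounded⇒length≤ {A} {ns} unique bounded = injective⇒≤ {f = code} code-injective
  where
  code : Fin (length ns) → Fin A
  code i = fromℕ< (All.lookup bounded (∈-lookup i))
  code-injective : ∀ {i j} → code i ≡ code j → i ≡ j
  code-injective {i} {j} eq = lookup-injective unique i j
    (trans (sym (toℕ-fromℕ< _)) (trans (cong toℕ eq) (toℕ-fromℕ< _)))

unique∧bounded∧length≥⇒∈ : ∀ {A ns ρ} → Unique ns → All (_< A) ns → A ≤ length ns → ρ < A → ρ ∈ ns
unique∧bounded∧length≥⇒∈ {A} {ns} {ρ} unique bounded long ρ<A with ρ ∈? ns
... | yes ρ∈ns = ρ∈ns
... | no  ρ∉ns = contradiction long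
  (<⇒≱ (unique∧bounded⇒length≤ (All.¬Any⇒All¬ ns ρ∉ns ∷ unique) (ρ<A ∷ bounded)))

length-concat : ∀ {A : Set} (xss : List (List A)) → length (concat xss) ≡ sum (map length xss)
length-concat []         = refl
length-concat (xs ∷ xss) = trans (length-++ xs) (cong (length xs +_) (length-concat xss))

module Claims {n} (g : Fin n → ℕ) (c : Fin n → ℕ → ℕ) where

  open ≡-Reasoning

  block : Fin n → List ℕ
  block u = applyUpTo (c u) (g u)

  claims : List ℕ
  claims = concatMap block (allFin n)

  Claimed : ℕ → Set
  Claimed ρ = ∃₂ λ u t → t < g u × c u t ≡ ρ

  Injective : Set
  Injective = ∀ {u v t s} → t < g u → s < g v → c u t ≡ c v s → u ≡ v × t ≡ s

  length-claims : length claims ≡ cost n g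
  length-claims = begin
    length claims                            ≡⟨ length-concat (map block (allFin n)) ⟩
    sum (map length (map block (allFin n)))  ≡⟨ cong sum (map-∘ (allFin n)) ⟨
    sum (map (length ∘ block) (allFin n))    ≡⟨ cong sum (map-cong (λ u → length-applyUpTo (c u) (g u)) (allFin n)) ⟩
    sum (map g (allFin n))                   ∎

  ∈-claims⁻ : ∀ {ρ} → ρ ∈ claims → Claimed ρ
  ∈-claims⁻ ρ∈ with _ , ρ∈b , b∈ ← ∈-concat⁻′ (map block (allFin n)) ρ∈
               with u , _ , refl  ← ∈-map⁻ block b∈
               with t , t<g , refl ← ∈-applyUpTo⁻ (c u) ρ∈b = u , t , t<g , refl

  claims-unique : Injective → Unique claims
  claims-unique inj =
    Unique.concat⁺ (All.map⁺ (All.tabulate⁺ block-unique)) (AllPairs.map⁺ (AllPairs.tabulate⁺ blocks-disjoint))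
    where
    block-unique : ∀ u → Unique (block u)
    block-unique u =
      Unique.applyUpTo⁺₁ (c u) (g u) λ i<j j<g eq → <⇒≢ i<j (proj₂ (inj (<-trans i<j j<g) j<g eq))
    blocks-disjoint : ∀ {u v} → u ≢ v → Disjoint (block u) (block v)
    blocks-disjoint {u} {v} u≢v (ρ∈u , ρ∈v)
      with t , t<g , refl ← ∈-applyUpTo⁻ (c u) ρ∈u
      with s , s<g , eq   ← ∈-applyUpTo⁻ (c v) ρ∈v = u≢v (proj₁ (inj t<g s<g eq))

  module _ {A} (inj : Injective) (bounded : ∀ {u t} → t < g u → c u t < A) where

    claims-bounded : All (_< A) claims
    claims-bounded = All.tabulate λ ρ∈ → claimed-bounded (∈-claims⁻ ρ∈)
      where
      claimed-bounded : ∀ {ρ} → Claimed ρ → ρ < A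
      claimed-bounded (_ , _ , t<g , refl) = bounded t<g

    cost≤ : cost n g ≤ A
    cost≤ = subst (_≤ A) length-claims (unique∧bounded⇒length≤ (claims-unique inj) claims-bounded)

    cost≥⇒claimed : A ≤ cost n g → ∀ {ρ} → ρ < A → Claimed ρ
    cost≥⇒claimed long ρ<A = ∈-claims⁻ (unique∧bounded∧length≥⇒∈ (claims-unique inj) claims-bounded
      (subst (A ≤_) (sym length-claims) long) ρ<A)

-- The circulant graphs C(n;1,a)

module Circulant (n a : ℕ) .{{_ : NonZero n}} where

  open ≡-Reasoning

  vertex : ℕ → Fin n
  vertex x = fromℕ< (m%n<n x n)

  toℕ-vertex : ∀ x → toℕ (vertex x) ≡ x % n
  toℕ-vertex x = toℕ-fromℕ< (m%n<n x n)

  vertex-toℕ : ∀ u → vertex (toℕ u) ≡ u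
  vertex-toℕ u = toℕ-injective (trans (toℕ-vertex (toℕ u)) (m<n⇒m%n≡m (toℕ<n u)))

  vertex-cong : ∀ {x y} → x % n ≡ y % n → vertex x ≡ vertex y
  vertex-cong {x} {y} eq = toℕ-injective (trans (toℕ-vertex x) (trans eq (sym (toℕ-vertex y))))

  vertex-+n : ∀ x → vertex (x + n) ≡ vertex x
  vertex-+n x = vertex-cong ([m+n]%n≡m%n x n)

  vertex-+ : ∀ x d → vertex (toℕ (vertex x) + d) ≡ vertex (x + d)
  vertex-+ x d = vertex-cong (trans (cong (λ r → (r + d) % n) (toℕ-vertex x)) ([m%n+o]%n≡[m+o]%n x d n))

  stepBy-vertex : ∀ x {s} → s < n → StepBy n s (vertex x) (vertex (x + s))
  stepBy-vertex x {s} s<n with x % n + s <? n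
  ... | yes no-wrap = inj₁ (begin
    toℕ (vertex (x + s))  ≡⟨ toℕ-vertex (x + s) ⟩
    (x + s) % n           ≡⟨ [m%n+o]%n≡[m+o]%n x s n ⟨
    (x % n + s) % n       ≡⟨ m<n⇒m%n≡m no-wrap ⟩
    x % n + s             ≡⟨ cong (_+ s) (toℕ-vertex x) ⟨
    toℕ (vertex x) + s    ∎)
  ... | no wrap with r , n+r≡ ← m≤n⇒∃[o]m+o≡n (≮⇒≥ wrap) = inj₂ (begin
    toℕ (vertex (x + s)) + n  ≡⟨ cong (_+ n) (toℕ-vertex (x + s)) ⟩
    (x + s) % n + n           ≡⟨ cong (_+ n) ([m%n+o]%n≡[m+o]%n x s n) ⟨
    (x % n + s) % n + n       ≡⟨ cong (λ z → z % n + n) n+r≡ ⟨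
    (n + r) % n + n           ≡⟨ cong (_+ n) (%-remove-+ˡ r (∣-refl {n})) ⟩
    r % n + n                 ≡⟨ cong (_+ n) (m<n⇒m%n≡m r<n) ⟩
    r + n                     ≡⟨ +-comm r n ⟩
    n + r                     ≡⟨ n+r≡ ⟩
    x % n + s                 ≡⟨ cong (_+ s) (toℕ-vertex x) ⟨
    toℕ (vertex x) + s        ∎)
    where
    r<n : r < n
    r<n = +-cancelˡ-< n r n (subst (_< n + n) (sym n+r≡) (+-mono-< (m%n<n x n) s<n))

  Adj-sym : ∀ {u v} → Adj n a u v → Adj n a v u
  Adj-sym (inj₁ e)               = inj₂ (inj₁ e)
  Adj-sym (inj₂ (inj₁ e))        = inj₁ e
  Adj-sym (inj₂ (inj₂ (inj₁ e))) = inj₂ (inj₂ (inj₂ e))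
  Adj-sym (inj₂ (inj₂ (inj₂ e))) = inj₂ (inj₂ (inj₁ e))

  adj-suc : 1 < n → ∀ x → Adj n a (vertex x) (vertex (x + 1))
  adj-suc 1<n x = inj₁ (stepBy-vertex x 1<n)

  adj-chord : a < n → ∀ x → Adj n a (vertex x) (vertex (x + a))
  adj-chord a<n x = inj₂ (inj₂ (inj₁ (stepBy-vertex x a<n)))

  _++ʷ_ : ∀ {u v w j k} → Walk n a u v j → Walk n a v w k → Walk n a u w (j + k)
  nil      ++ʷ q = q
  cons e p ++ʷ q = cons e (p ++ʷ q)

  Walk-0⇒≡ : ∀ {u v} → Walk n a u v 0 → u ≡ v
  Walk-0⇒≡ nil = refl

  DistLE : Fin n → Fin n → ℕ → Set
  DistLE u v k = ∃ λ j → j ≤ k × Walk n a u v j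

  DistLE-refl : ∀ {u} → DistLE u u 0
  DistLE-refl = 0 , z≤n , nil

  DistLE-adj : ∀ {u v} → Adj n a u v → DistLE u v 1
  DistLE-adj e = 1 , ≤-refl , cons e nil

  DistLE-trans : ∀ {u v w j k} → DistLE u v j → DistLE v w k → DistLE u w (j + k)
  DistLE-trans (_ , j′≤j , p) (_ , k′≤k , q) = _ , +-mono-≤ j′≤j k′≤k , p ++ʷ q

  DistGE⇒≤ : ∀ {u v j k} → DistGE n a u v k → DistLE u v j → k ≤ j
  DistGE⇒≤ ge (i , i≤j , p) = ≤-trans (ge i p) i≤j

  DistLE-forward : 1 < n → ∀ u d → DistLE u (vertex (toℕ u + d)) d
  DistLE-forward 1<n u zero    =
    subst (λ w → DistLE u w 0) (sym (trans (cong vertex (+-identityʳ (toℕ u))) (vertex-toℕ u))) DistLE-refl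
  DistLE-forward 1<n u (suc d) =
    subst₂ (λ x k → DistLE u (vertex x) k) (trans (+-assoc (toℕ u) d 1) (cong (toℕ u +_) (+-comm d 1))) (+-comm d 1)
      (DistLE-trans (DistLE-forward 1<n u d) (DistLE-adj (adj-suc 1<n (toℕ u + d))))

  ≤1∧nonadjacent⇒independent : 1 < n → ∀ {f} → (∀ v → f v ≤ 1) →
                               (∀ {u v} → 0 < f u → 0 < f v → ¬ Adj n a u v) → IsIndependent n a f
  ≤1∧nonadjacent⇒independent 1<n {f} f≤1 nonadjacent = (λ v → vertex (toℕ v + 1) , far-from-next v) , far
    where
    far-from-next : ∀ v j → Walk n a v (vertex (toℕ v + 1)) j → f v ≤ j
    far-from-next v zero    w = ⊥-elim ([m+o]%n≢m%n (toℕ v) z<s 1<n (begin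
      (toℕ v + 1) % n           ≡⟨ toℕ-vertex (toℕ v + 1) ⟨
      toℕ (vertex (toℕ v + 1))  ≡⟨ cong toℕ (Walk-0⇒≡ w) ⟨
      toℕ v                     ≡⟨ m<n⇒m%n≡m (toℕ<n v) ⟨
      toℕ v % n                 ∎))
    far-from-next v (suc j) _ = ≤-trans (f≤1 v) (s≤s z≤n)
    far : ∀ u v → u ≢ v → 0 < f u → 0 < f v → DistGE n a u v (suc (f u ⊔ f v))
    far u v u≢v _    _    zero          nil          = contradiction refl u≢v
    far u v _   0<fu 0<fv (suc zero)    (cons e nil) = contradiction e (nonadjacent 0<fu 0<fv)
    far u v _   _    _    (suc (suc j)) _            = s≤s (≤-trans (⊔-lub (f≤1 u) (f≤1 v)) (s≤s z≤n))

module CirculantMultiple (m a : ℕ) .{{_ : NonZero m}} .{{_ : NonZero a}} where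

  open ≡-Reasoning

  n : ℕ
  n = m * a

  instance
    n-nonZero : NonZero n
    n-nonZero = m*n≢0 m a

  open Circulant n a public

  a∣n : a ∣ n
  a∣n = divides m refl

  residue-vertex : ∀ x t → (toℕ (vertex x) + t) % a ≡ (x + t) % a
  residue-vertex x t = begin
    (toℕ (vertex x) + t) % a  ≡⟨ cong (λ r → (r + t) % a) (toℕ-vertex x) ⟩
    (x % n + t) % a           ≡⟨ [m%n+o]%n≡[m+o]%n (x % n) t a ⟨
    (x % n % a + t) % a       ≡⟨ cong (λ r → (r + t) % a) (m∣n⇒o%n%m≡o%m a n x a∣n) ⟩
    (x % a + t) % a           ≡⟨ [m%n+o]%n≡[m+o]%n x t a ⟩
    (x + t) % a               ∎

  -- v and x % n differ by D = qa modulo n, and q may be reduced modulo m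
  same-residue⇒translate : ∀ x v → x % a ≡ toℕ v % a → ∃ λ k → k < m × v ≡ vertex (x + k * a)
  same-residue⇒translate x v x≡v = q % m , m%n<n q m , sym (trans (vertex-cong shift) (vertex-toℕ v))
    where
    y = toℕ v
    x′ = x % n
    D = n + y ∸ x′
    x′+D≡n+y : x′ + D ≡ n + y
    x′+D≡n+y = m+[n∸m]≡n (≤-trans (m%n≤n x n) (m≤m+n n y))
    D%a≡0 : D % a ≡ 0
    D%a≡0 = trans (%-cancelˡ-+ x′ D 0 a (begin
      (x′ + D) % a  ≡⟨ cong (_% a) x′+D≡n+y ⟩
      (n + y) % a   ≡⟨ %-remove-+ˡ y a∣n ⟩
      y % a         ≡⟨ x≡v ⟨
      x % a         ≡⟨ m∣n⇒o%n%m≡o%m a n x a∣n ⟨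
      x′ % a        ≡⟨ cong (_% a) (+-identityʳ x′) ⟨
      (x′ + 0) % a  ∎)) (m<n⇒m%n≡m (>-nonZero⁻¹ a))
    q = D / a
    D≡qa : D ≡ q * a
    D≡qa = trans (m≡m%n+[m/n]*n D a) (cong (_+ q * a) D%a≡0)
    arith : ∀ x k j m a → x + k * a + j * (m * a) ≡ x + (k + j * m) * a
    arith = solve-∀
    shift : (x + q % m * a) % n ≡ y % n
    shift = begin
      (x + q % m * a) % n                ≡⟨ [m+kn]%n≡m%n _ (q / m) n ⟨
      (x + q % m * a + q / m * n) % n    ≡⟨ cong (_% n) (arith x (q % m) (q / m) m a) ⟩
      (x + (q % m + q / m * m) * a) % n  ≡⟨ cong (λ r → (x + r * a) % n) (m≡m%n+[m/n]*n q m) ⟨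
      (x + q * a) % n                    ≡⟨ [m%n+o]%n≡[m+o]%n x _ n ⟨
      (x′ + q * a) % n                   ≡⟨ cong (λ r → (x′ + r) % n) D≡qa ⟨
      (x′ + D) % n                       ≡⟨ cong (_% n) x′+D≡n+y ⟩
      (n + y) % n                        ≡⟨ %-remove-+ˡ y (∣-refl {n}) ⟩
      y % n                              ∎

  module TwoOrThree (2≤m : 2 ≤ m) (m≤3 : m ≤ 3) where

    a<n : a < n
    a<n = subst (a <_) (*-comm a m) (m<m*n a m 2≤m)

    1<n : 1 < n
    1<n = ≤-<-trans (>-nonZero⁻¹ a) a<n

    a+a≤n : a + a ≤ n
    a+a≤n = subst (_≤ n) (cong (a +_) (+-identityʳ a)) (*-monoˡ-≤ a 2≤m)

    same-residue⇒DistLE-1 : ∀ x v → x % a ≡ toℕ v % a → DistLE (vertex x) v 1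
    same-residue⇒DistLE-1 x v x≡v with same-residue⇒translate x v x≡v
    ... | 0 , _ , refl = 0 , z≤n , subst (λ y → Walk n a (vertex x) (vertex y) 0) (sym (+-identityʳ x)) nil
    ... | 1 , _ , refl =
      DistLE-adj (subst (λ b → Adj n a (vertex x) (vertex (x + b))) (sym (+-identityʳ a)) (adj-chord a<n x))
    ... | 2 , 2<m , refl = DistLE-adj (Adj-sym (subst (Adj n a _) around (adj-chord a<n (x + 2 * a))))
      where
      arith : ∀ x a → x + 2 * a + a ≡ x + 3 * a
      arith = solve-∀
      -- here m = 3, so one more chord closes the cycle
      around : vertex (x + 2 * a + a) ≡ vertex x
      around = trans (cong vertex (trans (arith x a) (cong (λ k → x + k * a) (≤-antisym 2<m m≤3))))
                     (vertex-+n x)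
    ... | suc (suc (suc _)) , k<m , _ = contradiction (≤-trans k<m m≤3) λ { (s≤s (s≤s (s≤s ()))) }

    residue⇒DistLE : ∀ u d v → (toℕ u + d) % a ≡ toℕ v % a → DistLE u v (suc d)
    residue⇒DistLE u d v eq = subst (DistLE u v) (+-comm d 1)
      (DistLE-trans (DistLE-forward 1<n u d) (same-residue⇒DistLE-1 (toℕ u + d) v eq))

    broadcast≤a : ∀ {g} → IsBroadcast n a g → ∀ u → g u ≤ a
    broadcast≤a bc u with w , far ← bc u with d , d<a , eq ← ∃-offset (toℕ u) (toℕ w) a =
      ≤-trans (DistGE⇒≤ far (residue⇒DistLE u d w eq)) d<a

    module Independent {g : Fin n → ℕ} (ind : IsIndependent n a g) where

      far : ∀ {u v j} → u ≢ v → 0 < g u → 0 < g v → DistLE u v j → g u ⊔ g v < j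
      far u≢v 0<gu 0<gv = DistGE⇒≤ (proj₂ ind _ _ u≢v 0<gu 0<gv)

      claim : Fin n → ℕ → ℕ
      claim u t = (toℕ u + t) % a

      claim-cancel : ∀ u v k t s → claim u (k + t) ≡ claim v (k + s) → claim u t ≡ claim v s
      claim-cancel u v k t s eq = %-cancelˡ-+ k (toℕ u + t) (toℕ v + s) a
        (trans (cong (_% a) (sym (x∙yz≈y∙xz (toℕ u) k t))) (trans eq (cong (_% a) (x∙yz≈y∙xz (toℕ v) k s))))

      claim-injective-≤ : ∀ {u v t s} → s ≤ t → t < g u → s < g v → claim u t ≡ claim v s → u ≡ v × t ≡ s
      claim-injective-≤ {u} {v} {s = s} s≤t t<gu s<gv eq
        with e , refl ← m≤n⇒∃[o]m+o≡n s≤t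
        with shifted  ← trans (claim-cancel u v s e 0 (trans eq (cong (claim v) (sym (+-identityʳ s)))))
                              (cong (_% a) (+-identityʳ (toℕ v)))
        with u ≟ᶠ v
      ... | no u≢v =
        contradiction (far u≢v (≤-<-trans z≤n t<gu) (≤-<-trans z≤n s<gv) (residue⇒DistLE u e v shifted))
                      (≤⇒≯ (≤-trans (≤-<-trans (m≤n+m e s) t<gu) (m≤m⊔n (g u) (g v))))
      ... | yes refl with e
      ...   | zero  = refl , +-identityʳ s
      ...   | suc d = contradiction shifted ([m+o]%n≢m%n (toℕ u) z<s 1+d<a)
        where
        1+d<a : suc d < a
        1+d<a = <-≤-trans (≤-<-trans (m≤n+m (suc d) s) t<gu) (broadcast≤a (proj₁ ind) u)

      claim-injective : Claims.Injective g claim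
      claim-injective {t = t} {s} t<gu s<gv eq with ≤-total s t
      ... | inj₁ s≤t = claim-injective-≤ s≤t t<gu s<gv eq
      ... | inj₂ t≤s with refl , refl ← claim-injective-≤ t≤s s<gv t<gu (sym eq) = refl , refl

      open Claims g claim using (cost≤; cost≥⇒claimed) public

      cost≤a : cost n g ≤ a
      cost≤a = cost≤ claim-injective (λ {u} {t} _ → m%n<n (toℕ u + t) a)

-- An independent broadcast of cost a, or a − 1

module Construction (m a : ℕ) .{{_ : NonZero m}} .{{_ : NonZero a}} (2≤m : 2 ≤ m) (m≤3 : m ≤ 3)
                    (b : ℕ) (b≤a : b ≤ a) where

  open CirculantMultiple m a
  open TwoOrThree 2≤m m≤3

  F : ℕ → ℕ
  F x with x <? a | x <? a + b
  ... | yes _ | _     = isEven x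
  ... | no  _ | yes _ = isOdd (x ∸ a)
  ... | no  _ | no  _ = 0

  F-block₀ : ∀ {x} → x < a → F x ≡ isEven x
  F-block₀ {x} x<a with x <? a
  ... | yes _   = refl
  ... | no  x≮a = contradiction x<a x≮a

  F-block₁ : ∀ {y} → y < b → F (a + y) ≡ isOdd y
  F-block₁ {y} y<b with a + y <? a | a + y <? a + b
  ... | yes a+y<a | _          = contradiction a+y<a (m+n≮m a y)
  ... | no  _     | yes _      = cong isOdd (m+n∸m≡n a y)
  ... | no  _     | no  a+y≮ = contradiction (+-monoʳ-< a y<b) a+y≮

  F-tail : ∀ {x} → a + b ≤ x → F x ≡ 0
  F-tail {x} a+b≤x with x <? a | x <? a + b
  ... | yes x<a | _         = contradiction (≤-trans (m≤m+n a b) a+b≤x) (<⇒≱ x<a)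
  ... | no  _   | yes x<a+b = contradiction a+b≤x (<⇒≱ x<a+b)
  ... | no  _   | no  _     = refl

  F≤1 : ∀ x → F x ≤ 1
  F≤1 x with x <? a | x <? a + b
  ... | yes _ | _     = isEven≤1 x
  ... | no  _ | yes _ = isOdd≤1 (x ∸ a)
  ... | no  _ | no  _ = z≤n

  Positive : ℕ → Set
  Positive x = (x < a × isEven x ≡ 1) ⊎ (∃ λ y → x ≡ a + y × y < b × isOdd y ≡ 1)

  F-positive : ∀ {x} → 0 < F x → Positive x
  F-positive {x} 0<Fx with x <? a | x <? a + b
  ... | yes x<a | _         = inj₁ (x<a , ≤-antisym (isEven≤1 x) 0<Fx)
  ... | no  x≮a | yes x<a+b = inj₂ (x ∸ a , sym (m+[n∸m]≡n a≤x) ,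
                                    +-cancelˡ-< a _ b (subst (_< a + b) (sym (m+[n∸m]≡n a≤x)) x<a+b) ,
                                    ≤-antisym (isOdd≤1 (x ∸ a)) 0<Fx)
    where
    a≤x = ≮⇒≥ x≮a
  ... | no  _   | no  _     = contradiction 0<Fx λ ()

  cost≥b : b ≤ cost n (F ∘ toℕ)
  cost≥b = begin
    b                                                          ≡⟨ sum-isEven+sum-isOdd b ⟨
    sum (applyUpTo isEven b) + sum (applyUpTo isOdd b)         ≤⟨ +-monoˡ-≤ _ (sum-applyUpTo-≤ isEven b≤a) ⟩
    sum (applyUpTo isEven a) + sum (applyUpTo isOdd b)         ≡⟨ cong₂ _+_ (sum-applyUpTo-cong a F-block₀)
                                                                              (sum-applyUpTo-cong b F-block₁) ⟨
    sum (applyUpTo F a) + sum (applyUpTo (F ∘ (a +_)) b)       ≡⟨ sum-applyUpTo-+ F a b ⟨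
    sum (applyUpTo F (a + b))                                  ≤⟨ sum-applyUpTo-≤ F a+b≤n ⟩
    sum (applyUpTo F n)                                        ≡⟨ cost-toℕ n F ⟨
    cost n (F ∘ toℕ)                                           ∎
    where
    open ≤-Reasoning
    a+b≤n : a + b ≤ n
    a+b≤n = ≤-trans (+-monoʳ-≤ a b≤a) a+a≤n

  Positive<a+a : ∀ {x} → Positive x → x < a + a
  Positive<a+a (inj₁ (x<a , _))            = ≤-trans x<a (m≤m+n a a)
  Positive<a+a (inj₂ (y , refl , y<b , _)) = +-monoʳ-< a (≤-trans y<b b≤a)

  consecutive-positive : ∀ {x} → Positive x → Positive (suc x) → ⊥
  consecutive-positive {x} (inj₁ (_ , even)) (inj₁ (_ , odd)) = isEven≡1∧isOdd≡1⇒⊥ x even odd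
  consecutive-positive (inj₁ (_ , _)) (inj₂ (zero , _ , _ , ()))
  consecutive-positive (inj₁ (x<a , _)) (inj₂ (suc y , 1+x≡a+1+y , _ , _)) =
    m+1+n≰m a (subst (_≤ a) 1+x≡a+1+y x<a)
  consecutive-positive (inj₂ (y , refl , _ , _)) (inj₁ (1+a+y<a , _)) =
    m+n≮m a y (<-trans (n<1+n (a + y)) 1+a+y<a)
  consecutive-positive (inj₂ (y , refl , _ , odd)) (inj₂ (y′ , 1+a+y≡a+y′ , _ , odd′))
    with refl ← +-cancelˡ-≡ a (suc y) y′ (trans (+-suc a y) 1+a+y≡a+y′) = isEven≡1∧isOdd≡1⇒⊥ y odd′ odd

  chord-positive : ∀ {x} → Positive x → Positive (x + a) → ⊥
  chord-positive {x} _ (inj₁ (x+a<a , _)) = m+n≮n x a x+a<a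
  chord-positive {x} p (inj₂ (y , x+a≡a+y , y<b , odd))
    with refl ← +-cancelˡ-≡ a x y (trans (+-comm a x) x+a≡a+y) with p
  ... | inj₁ (_ , even)          = isEven≡1∧isOdd≡1⇒⊥ x even odd
  ... | inj₂ (x′ , refl , _ , _) = <⇒≱ y<b (≤-trans b≤a (m≤m+n a x′))

  -- the hypotheses force m = 2
  wrap-chord-shift : ∀ {x y} → x < a + a → y + n ≡ x + a → a + y ≡ x
  wrap-chord-shift {x} {y} x<a+a y+n≡x+a =
    +-cancelʳ-≡ a (a + y) x (trans (arith a y) (trans (cong (y +_) (sym n≡a+a)) y+n≡x+a))
    where
    open ≤-Reasoning
    arith : ∀ a y → a + y + a ≡ y + (a + a)
    arith = solve-∀
    triple : ∀ a → a + a + a ≡ 3 * a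
    triple = solve-∀
    n<3*a : n < 3 * a
    n<3*a = begin-strict
      n          ≤⟨ m≤n+m n y ⟩
      y + n      ≡⟨ y+n≡x+a ⟩
      x + a      <⟨ +-monoˡ-< a x<a+a ⟩
      a + a + a  ≡⟨ triple a ⟩
      3 * a      ∎
    n≡a+a : n ≡ a + a
    n≡a+a = trans (cong (_* a) (≤-antisym (s≤s⁻¹ (*-cancelʳ-< a m 3 n<3*a)) 2≤m)) (cong (a +_) (+-identityʳ a))

  wrap-chord-positive : ∀ {x y} → Positive x → Positive y → y + n ≡ x + a → ⊥
  wrap-chord-positive {x} {y} px py y+n≡x+a with a+y≡x ← wrap-chord-shift (Positive<a+a px) y+n≡x+a with px
  ... | inj₁ (x<a , _) = <⇒≱ x<a (subst (a ≤_) a+y≡x (m≤m+n a y))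
  ... | inj₂ (x′ , x≡a+x′ , x′<b , odd) with refl ← +-cancelˡ-≡ a y x′ (trans a+y≡x x≡a+x′) with py
  ...   | inj₁ (_ , even)          = isEven≡1∧isOdd≡1⇒⊥ y even odd
  ...   | inj₂ (y′ , refl , _ , _) = <⇒≱ x′<b (≤-trans b≤a (m≤m+n a y′))

  f : Fin n → ℕ
  f = F ∘ toℕ

  module _ (last-free : ∀ {x} → suc x ≡ n → F x ≡ 0) where

    ¬step-positive : ∀ {u v} → 0 < f u → 0 < f v → ¬ StepBy n 1 u v
    ¬step-positive pu pv (inj₁ v≡u+1) =
      consecutive-positive (F-positive pu) (subst Positive (trans v≡u+1 (+-comm _ 1)) (F-positive pv))
    ¬step-positive {u} {v} pu _ (inj₂ v+n≡u+1) = <⇒≢ pu (sym (last-free (≤-antisym (toℕ<n u) n≤1+u)))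
      where
      n≤1+u : n ≤ suc (toℕ u)
      n≤1+u = subst (n ≤_) (trans v+n≡u+1 (+-comm _ 1)) (m≤n+m n (toℕ v))

    ¬chord-positive : ∀ {u v} → 0 < f u → 0 < f v → ¬ StepBy n a u v
    ¬chord-positive pu pv (inj₁ v≡u+a)   = chord-positive (F-positive pu) (subst Positive v≡u+a (F-positive pv))
    ¬chord-positive pu pv (inj₂ v+n≡u+a) = wrap-chord-positive (F-positive pu) (F-positive pv) v+n≡u+a

    nonadjacent : ∀ {u v} → 0 < f u → 0 < f v → ¬ Adj n a u v
    nonadjacent pu pv (inj₁ e)                = ¬step-positive pu pv e
    nonadjacent pu pv (inj₂ (inj₁ e))         = ¬step-positive pv pu e
    nonadjacent pu pv (inj₂ (inj₂ (inj₁ e)))  = ¬chord-positive pu pv e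
    nonadjacent pu pv (inj₂ (inj₂ (inj₂ e)))  = ¬chord-positive pv pu e

    independent : IsIndependent n a f
    independent = ≤1∧nonadjacent⇒independent 1<n (F≤1 ∘ toℕ) nonadjacent

    2-bounded : TwoBounded n f
    2-bounded v = ≤-trans (F≤1 (toℕ v)) (n≤1+n 1)

    admits : (∀ g → IsIndependent n a g → cost n g ≤ b) → Admits2BoundedBeta n a
    admits optimal = f , (independent , λ g ind → ≤-trans (optimal g ind) cost≥b) , 2-bounded

-- C(2a;1,a) is the Möbius ladder on 2a vertices.
module MöbiusLadder (a : ℕ) .{{_ : NonZero a}} (2≤a : 2 ≤ a) where

  open ≡-Reasoning
  open CirculantMultiple 2 a
  open TwoOrThree ≤-refl (n≤1+n 2)

  same-residue⇒antipodal : ∀ x v → x % a ≡ toℕ v % a → v ≡ vertex x ⊎ v ≡ vertex (x + a)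
  same-residue⇒antipodal x v x≡v with same-residue⇒translate x v x≡v
  ... | 0 , _ , refl = inj₁ (cong vertex (+-identityʳ x))
  ... | 1 , _ , refl = inj₂ (cong (λ b → vertex (x + b)) (+-identityʳ a))
  ... | suc (suc _) , s≤s (s≤s ()) , _

  diameter<a : ∀ u w → ∃ λ j → j < a × DistLE u w j
  diameter<a u w with d , d<a , eq ← ∃-offset (toℕ u) (toℕ w) a with suc d <? a
  ... | yes 1+d<a = suc d , 1+d<a , residue⇒DistLE u d w eq
  ... | no  1+d≮a with same-residue⇒antipodal (toℕ u + d) w eq
  ...   | inj₁ refl = d , d<a , DistLE-forward 1<n u d
  ...   | inj₂ refl = 1 , 2≤a , DistLE-adj (Adj-sym (subst (Adj n a _) around (adj-suc 1<n (toℕ u + d + a))))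
    where
    -- here d = a - 1, so one more step closes the cycle
    around : vertex (toℕ u + d + a + 1) ≡ u
    around = begin
      vertex (toℕ u + d + a + 1)    ≡⟨ cong vertex (arith (toℕ u) d a) ⟩
      vertex (toℕ u + (suc d + a))  ≡⟨ cong (λ b → vertex (toℕ u + (b + a))) (≤-antisym d<a (≮⇒≥ 1+d≮a)) ⟩
      vertex (toℕ u + (a + a))      ≡⟨ cong (λ b → vertex (toℕ u + (a + b))) (+-identityʳ a) ⟨
      vertex (toℕ u + n)            ≡⟨ vertex-+n (toℕ u) ⟩
      vertex (toℕ u)                ≡⟨ vertex-toℕ u ⟩
      u                             ∎
      where
      arith : ∀ x d a → x + d + a + 1 ≡ x + (suc d + a)
      arith = solve-∀

  broadcast<a : ∀ {g} → IsBroadcast n a g → ∀ u → g u < a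
  broadcast<a bc u with w , far ← bc u with j , j<a , u~w ← diameter<a u w = ≤-<-trans (DistGE⇒≤ far u~w) j<a

  module Perfect {g : Fin n → ℕ} (ind : IsIndependent n a g) (perfect : a ≤ cost n g) where

    open Independent ind
    open Claims g claim using (Claimed)

    claimed : ∀ ρ → ρ < a → Claimed ρ
    claimed ρ = cost≥⇒claimed claim-injective (λ {u} {t} _ → m%n<n (toℕ u + t) a) perfect

    next-claimant : ∀ {v k} → g v ≡ suc k → ∃ λ w → v ≢ w × 0 < g w × (toℕ v + suc k) % a ≡ toℕ w % a
    next-claimant {v} {k} gv≡1+k with claimed (claim v (suc k)) (m%n<n _ a)
    ... | w , suc s , 1+s<gw , eq
          with refl , refl ← claim-injective (<-trans (n<1+n s) 1+s<gw) (subst (k <_) (sym gv≡1+k) ≤-refl)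
                                             (claim-cancel w v 1 s k eq)
          = contradiction (subst (suc k <_) gv≡1+k 1+s<gw) (<-irrefl refl)
    ... | w , zero , 0<gw , eq with v ≟ᶠ w
    ...   | yes refl = contradiction (sym (trans (cong (_% a) (sym (+-identityʳ (toℕ v)))) eq))
                         ([m+o]%n≢m%n (toℕ v) z<s (subst (_< a) gv≡1+k (broadcast<a (proj₁ ind) v)))
    ...   | no  v≢w  = w , v≢w , 0<gw , sym (trans (cong (_% a) (sym (+-identityʳ (toℕ w)))) eq)

    jump : Fin n → ℕ → Fin n
    jump v K = vertex (toℕ v + (K + a))

    jump-value : ∀ {v K} → g v ≡ K → 0 < K → 0 < g (jump v K) × g (jump v K) ≤ K
    jump-value {v} {suc k} gv≡1+k 0<gv
      with w , v≢w , 0<gw , eq ← next-claimant gv≡1+k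
      with same-residue⇒antipodal (toℕ v + suc k) w eq
    ... | inj₁ refl = contradiction (far v≢w (subst (0 <_) (sym gv≡1+k) 0<gv) 0<gw (DistLE-forward 1<n v (suc k)))
                                    (≤⇒≯ (subst (_≤ g v ⊔ g w) gv≡1+k (m≤m⊔n (g v) (g w))))
    ... | inj₂ refl = subst (λ w → 0 < g w × g w ≤ suc k) (cong vertex (+-assoc (toℕ v) (suc k) a))
                        (0<gw , ≤-pred (≤-trans (s≤s (m≤n⊔m (g v) (g w)))
                          (subst (suc (g v ⊔ g w) ≤_) (+-comm (suc k) 1)
                            (far v≢w (subst (0 <_) (sym gv≡1+k) 0<gv) 0<gw v~w))))
      where
      v~w = DistLE-trans (DistLE-forward 1<n v (suc k)) (DistLE-adj (adj-chord a<n (toℕ v + suc k)))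

    module MinimalValue (p : ℕ) (a≡2^p : a ≡ 2 ^ p) (v₀ : Fin n) {K : ℕ} (gv₀≡K : g v₀ ≡ K) (0<K : 0 < K)
                        (minimal : ∀ v → 0 < g v → K ≤ g v) where

      instance
        K-nonZero : NonZero K
        K-nonZero = >-nonZero 0<K

      orbit : ℕ → Fin n
      orbit j = vertex (toℕ v₀ + j * (K + a))

      g-orbit : ∀ j → g (orbit j) ≡ K
      g-orbit zero = trans (cong g (trans (cong vertex (+-identityʳ (toℕ v₀))) (vertex-toℕ v₀))) gv₀≡K
      g-orbit (suc j) with 0<gw , gw≤K ← jump-value (g-orbit j) 0<K =
        subst (λ w → g w ≡ K) next (≤-antisym gw≤K (minimal _ 0<gw))
        where
        next : jump (orbit j) K ≡ orbit (suc j)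
        next = trans (vertex-+ _ (K + a))
          (cong vertex (trans (+-assoc (toℕ v₀) _ _) (cong (toℕ v₀ +_) (+-comm (j * (K + a)) (K + a)))))

      q = a / K
      ρ = a % K

      a≡ρ+qK : a ≡ ρ + q * K
      a≡ρ+qK = m≡m%n+[m/n]*n a K

      claims-meet : claim (orbit q) ρ ≡ claim v₀ 0
      claims-meet = begin
        claim (orbit q) ρ                   ≡⟨ residue-vertex (toℕ v₀ + q * (K + a)) ρ ⟩
        (toℕ v₀ + q * (K + a) + ρ) % a      ≡⟨ cong (_% a) (arith (toℕ v₀) q K a ρ) ⟩
        (toℕ v₀ + (ρ + q * K) + q * a) % a  ≡⟨ cong (λ r → (toℕ v₀ + r + q * a) % a) a≡ρ+qK ⟨
        (toℕ v₀ + a + q * a) % a            ≡⟨ [m+kn]%n≡m%n (toℕ v₀ + a) q a ⟩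
        (toℕ v₀ + a) % a                    ≡⟨ [m+n]%n≡m%n (toℕ v₀) a ⟩
        toℕ v₀ % a                          ≡⟨ cong (_% a) (+-identityʳ (toℕ v₀)) ⟨
        claim v₀ 0                          ∎
        where
        arith : ∀ x q K a ρ → x + q * (K + a) + ρ ≡ x + (ρ + q * K) + q * a
        arith = solve-∀

      orbit-q≡v₀ : orbit q ≡ v₀ × ρ ≡ 0
      orbit-q≡v₀ =
        claim-injective (subst (ρ <_) (sym (g-orbit q)) (m%n<n a K)) (subst (0 <_) (sym gv₀≡K) 0<K) claims-meet

      a≡qK : a ≡ q * K
      a≡qK = trans a≡ρ+qK (cong (_+ q * K) (proj₂ orbit-q≡v₀))

      -- an even q would make orbit q the antipode of v₀
      2∤q : 2 ∤ q
      2∤q (divides e q≡e*2) = [m+o]%n≢m%n (toℕ v₀) (>-nonZero⁻¹ a) a<n (begin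
        (toℕ v₀ + a) % n              ≡⟨ [m+kn]%n≡m%n (toℕ v₀ + a) e n ⟨
        (toℕ v₀ + a + e * n) % n      ≡⟨ cong (_% n) (arith₁ (toℕ v₀) e a) ⟩
        (toℕ v₀ + a + e * 2 * a) % n  ≡⟨ cong (λ r → (toℕ v₀ + a + r * a) % n) q≡e*2 ⟨
        (toℕ v₀ + a + q * a) % n      ≡⟨ cong (λ r → (toℕ v₀ + r + q * a) % n) a≡qK ⟩
        (toℕ v₀ + q * K + q * a) % n  ≡⟨ cong (_% n) (arith₂ (toℕ v₀) q K a) ⟩
        (toℕ v₀ + q * (K + a)) % n    ≡⟨ toℕ-vertex _ ⟨
        toℕ (orbit q)                 ≡⟨ cong toℕ (proj₁ orbit-q≡v₀) ⟩
        toℕ v₀                        ≡⟨ m<n⇒m%n≡m (toℕ<n v₀) ⟨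
        toℕ v₀ % n                    ∎)
        where
        arith₁ : ∀ x e a → x + a + e * (2 * a) ≡ x + a + e * 2 * a
        arith₁ = solve-∀
        arith₂ : ∀ x q K a → x + q * K + q * a ≡ x + q * (K + a)
        arith₂ = solve-∀

      K≡a : K ≡ a
      K≡a = begin
        K      ≡⟨ +-identityʳ K ⟨
        1 * K  ≡⟨ cong (_* K) (2∤m∧m∣2^n⇒m≡1 p 2∤q q∣2^p) ⟨
        q * K  ≡⟨ a≡qK ⟨
        a      ∎

        where
        q∣2^p : q ∣ 2 ^ p
        q∣2^p = divides K (trans (sym a≡2^p) (trans a≡qK (*-comm q K)))

      impossible : ⊥
      impossible = <-irrefl (trans gv₀≡K K≡a) (broadcast<a (proj₁ ind) v₀)

    no-positive-value : ∀ p → a ≡ 2 ^ p → ∀ v → 0 < g v → ⊥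
    no-positive-value p a≡2^p v = <-rec (λ K → ∀ v → g v ≡ K → 0 < K → ⊥) step (g v) v refl
      where
      step : ∀ K → (∀ {k} → k < K → ∀ v → g v ≡ k → 0 < k → ⊥) → ∀ v → g v ≡ K → 0 < K → ⊥
      step K smaller v gv≡K 0<K = MinimalValue.impossible p a≡2^p v gv≡K 0<K minimal
        where
        minimal : ∀ w → 0 < g w → K ≤ g w
        minimal w 0<gw with g w <? K
        ... | yes gw<K = ⊥-elim (smaller gw<K w refl 0<gw)
        ... | no  gw≮K = ≮⇒≥ gw≮K

  cost<a : ∀ p → a ≡ 2 ^ p → ∀ {g} → IsIndependent n a g → cost n g < a
  cost<a p a≡2^p {g} ind with a ≤? cost n g
  ... | no  imperfect = ≰⇒> imperfect
  ... | yes perfect with _ , _ , t<gu , _ ← Perfect.claimed ind perfect 0 (>-nonZero⁻¹ a) =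
    ⊥-elim (Perfect.no-positive-value ind perfect p a≡2^p _ (≤-<-trans z≤n t<gu))

admits-3a : ∀ a .{{_ : NonZero a}} → Admits2BoundedBeta (3 * a) a
admits-3a a = admits last-free λ _ ind → Independent.cost≤a ind
  where
  open Construction 3 a (n≤1+n 2) ≤-refl a ≤-refl
  open CirculantMultiple.TwoOrThree 3 a (n≤1+n 2) ≤-refl using (module Independent)
  last-free : ∀ {x} → suc x ≡ 3 * a → F x ≡ 0
  last-free {x} 1+x≡3a =
    F-tail (s≤s⁻¹ (subst (suc (a + a) ≤_) (trans (triple a) (sym 1+x≡3a)) (m<m+n (a + a) (>-nonZero⁻¹ a))))
    where
    triple : ∀ a → a + a + a ≡ 3 * a
    triple = solve-∀

admits-2a-odd : ∀ a .{{_ : NonZero a}} → Odd a → Admits2BoundedBeta (2 * a) a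
admits-2a-odd a (k , a≡1+2k) = admits last-free λ _ ind → Independent.cost≤a ind
  where
  open Construction 2 a ≤-refl (n≤1+n 2) a ≤-refl
  open CirculantMultiple.TwoOrThree 2 a ≤-refl (n≤1+n 2) using (module Independent)
  -- the last vertex a + 2k has even offset in the second block
  last-free : ∀ {x} → suc x ≡ 2 * a → F x ≡ 0
  last-free {x} 1+x≡2a =
    subst (λ y → F y ≡ 0) (sym x≡a+2k) (trans (F-block₁ (≤-reflexive (sym a≡1+2k))) (isOdd[2*n]≡0 k))
    where
    x≡a+2k : x ≡ a + 2 * k
    x≡a+2k = suc-injective (begin
      suc x              ≡⟨ 1+x≡2a ⟩
      a + (a + 0)        ≡⟨ cong (a +_) (trans (+-identityʳ a) a≡1+2k) ⟩
      a + suc (2 * k)    ≡⟨ +-suc a (2 * k) ⟩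
      suc (a + 2 * k)    ∎)
      where open ≡-Reasoning

admits-2a-2^p : ∀ a .{{_ : NonZero a}} → 2 ≤ a → ∀ p → a ≡ 2 ^ p → Admits2BoundedBeta (2 * a) a
admits-2a-2^p a 2≤a p a≡2^p =
  admits last-free λ g ind → ≤-pred (subst (cost (2 * a) g <_) (sym (suc-pred a)) (cost<a p a≡2^p ind))
  where
  open Construction 2 a ≤-refl (n≤1+n 2) (pred a) pred[n]≤n
  open MöbiusLadder a 2≤a using (cost<a)
  last-free : ∀ {x} → suc x ≡ 2 * a → F x ≡ 0
  last-free {x} 1+x≡2a = F-tail (≤-reflexive (suc-injective (begin
    suc (a + pred a)   ≡⟨ +-suc a (pred a) ⟨
    a + suc (pred a)   ≡⟨ cong (a +_) (trans (suc-pred a) (sym (+-identityʳ a))) ⟩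
    a + (a + 0)        ≡⟨ 1+x≡2a ⟨
    suc x              ∎)))
    where open ≡-Reasoning

proposition6 : ∀ (a : ℕ) → 2 ≤ a →
    ((Odd a ⊎ (∃ λ (p : ℕ) → 1 ≤ p × a ≡ 2 ^ p)) → Admits2BoundedBeta (2 * a) a)
    × Admits2BoundedBeta (3 * a) a
proposition6 a@(suc _) 2≤a =
  [ admits-2a-odd a , (λ (p , _ , a≡2^p) → admits-2a-2^p a 2≤a p a≡2^p) ] , admits-3a a
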